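{- Every downset $\mathcal{D}$ with $|U(\mathcal{D})|\le 4$ has the star property (i.e., Chvátal's conjecture holds for all such downsets).
   Context: $U(\mathcal{F})$ is the union of all sets in a family $\mathcal{F}$. A family $\mathcal{D}$ is a downset if $A\in\mathcal{D}$, $B\subseteq A$ imply $B\in\mathcal{D}$. A family is intersecting if any two of its sets have nonempty intersection; it is a star if some element of $U(\mathcal{F})$ lies in all its sets; $\mathcal{F}$ has the star property if some maximum-cardinality intersecting family contained in $\mathcal{F}$ is a star. -}

module Defs where

open import Data.Nat using (ℕ; _≤_)
open import Data.Fin using (Fin)
open import Data.Fin.Subset as S using (Subset; _∩_; _⊆_; ⋃; Nonempty; ∣_∣)
open import Data.List using (List; length)
import Data.List.Membership.Propositional as LM
open import Data.List.Relation.Unary.Unique.Propositional using (Unique)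
open import Data.Product using (∃; _×_; Σ)

-- A family of subsets of the ground set Fin n, given as a list.
-- Membership in the family is list membership; cardinality of a family is
-- the length of a duplicate-free list.
Family : ℕ → Set
Family n = List (Subset n)

U : ∀ {n} → Family n → Subset n
U = ⋃

IsDownset : ∀ {n} → Family n → Set
IsDownset D = ∀ {A B} → A LM.∈ D → B ⊆ A → B LM.∈ D

IsIntersecting : ∀ {n} → Family n → Set
IsIntersecting F = ∀ {A B} → A LM.∈ F → B LM.∈ F → Nonempty (A ∩ B)

IsStar : ∀ {n} → Family n → Set
IsStar {n} F = ∃ λ (x : Fin n) → (x S.∈ U F) × (∀ {A} → A LM.∈ F → x S.∈ A)

SubfamilyOf : ∀ {n} → Family n → Family n → Set
SubfamilyOf F D = Unique F × (∀ {A} → A LM.∈ F → A LM.∈ D)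

IsMaxIntersectingIn : ∀ {n} → Family n → Family n → Set
IsMaxIntersectingIn F D =
  SubfamilyOf F D × IsIntersecting F ×
  (∀ G → SubfamilyOf G D → IsIntersecting G → length G ≤ length F)

HasStarProperty : ∀ {n} → Family n → Set
HasStarProperty D = ∃ λ F → IsMaxIntersectingIn F D × IsStar F

-- Relabelling the ground set along an enumeration of U(D) turns D into a downset of
-- the k-cube with k ≤ 4, and the star property transfers back along the relabelling.
-- Every downset of the (k+1)-cube is glued from two downsets D₁ ⊆ D₀ of the k-cube
-- (its sections through a coordinate), which yields an explicit finite list of all
-- downsets of the k-cube. For each of them the size of a largest intersecting
-- subfamily (a clique number of the intersection graph) is computed and compared
-- with the sizes of the stars, by evaluation.
module Submission where

open import Defs
open import Data.Nat using (ℕ; zero; suc; _≤_; _⊔_; _≤?_; s≤s; z≤n)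
open import Data.Fin.Subset using (Nonempty; ∣_∣)
import Data.Bool.Properties as Bool
open import Data.Fin using (Fin; zero; suc)
open import Data.Fin.Properties using (suc-injective; any?)
import Data.Fin.Subset as S
open import Data.Fin.Subset using (Subset; Side; inside; outside; ⁅_⁆; _∩_)
open import Data.Fin.Subset.Properties
  using (nonempty?; s⊆s; out⊆; ⊆-refl; ⊆-antisym; ∉⊥; x∈⁅x⁆; x∈⁅y⁆⇒x≡y;
         x∈p∩q⁺; p∩q⊆p; p∩q⊆q; x∈p∪q⁺; x∈p∪q⁻)
  renaming (_∈?_ to _∈ₛ?_)
open import Data.List using (List; []; _∷_; [_]; _++_; map; filter; concatMap; length; allFin)
open import Data.List.Properties using (length-map)
open import Data.List.Membership.Propositional using (_∈_; _∉_)
open import Data.List.Membership.Propositional.Properties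
  using (∈-map⁺; ∈-map⁻; ∈-++⁺ˡ; ∈-++⁺ʳ; ∈-++⁻; ∈-concat⁺′; ∈-concat⁻′;
         ∈-filter⁺; ∈-filter⁻; ∈-map∘filter⁺; ∈-map∘filter⁻; ∈-allFin)
import Data.List.Membership.DecPropositional as DecMembership
open import Data.List.Relation.Binary.Subset.Propositional using (_⊆_)
import Data.List.Relation.Binary.Subset.Propositional.Properties as Subset
import Data.List.Relation.Binary.Subset.DecPropositional as DecSubset
open import Data.List.Relation.Unary.Any using (here; there)
open import Data.List.Relation.Unary.All as All using (All; []; _∷_)
open import Data.List.Relation.Unary.AllPairs using ([]; _∷_)
open import Data.List.Relation.Unary.Unique.Propositional using (Unique)
open import Data.List.Relation.Unary.Unique.Propositional.Properties
  using (map⁺; ++⁺; filter⁺; Unique[x∷xs]⇒x∉xs)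
open import Data.Nat.Properties using (≤-trans; ≤-refl; m≤m⊔n; m≤n⊔m; module ≤-Reasoning)
open import Data.Product using (∃-syntax; _×_; _,_; proj₁; proj₂)
open import Data.Sum using (inj₁; inj₂)
import Data.Vec as Vec
open import Data.Vec using ([]; _∷_; head; tail; lookup; tabulate)
open import Data.Vec.Properties using (≡-dec; ∷-injectiveʳ; lookup∘tabulate; []=⇒lookup; lookup⇒[]=)
open import Function using (_∘_)
open import Function.Definitions using (Injective)
open import Relation.Binary.Definitions using (Decidable; DecidableEquality)
open import Relation.Binary.PropositionalEquality using (_≡_; _≢_; refl; sym; trans; cong; subst)
open import Relation.Nullary using (¬_; Dec; yes; no; contradiction)
open import Relation.Nullary.Decidable using (from-yes)

module _ {A : Set} where

  ∈-tail : ∀ {x a} {xs : List A} → x ∈ a ∷ xs → x ≢ a → x ∈ xs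
  ∈-tail (here refl) x≢a = contradiction refl x≢a
  ∈-tail (there x∈xs) _ = x∈xs

  unique-remove : ∀ {x} {xs : List A} → x ∈ xs → Unique xs →
           ∃[ ys ] length xs ≡ suc (length ys) × Unique ys × ys ⊆ xs × x ∉ ys
  unique-remove (here refl) u@(_ ∷ u′) = _ , refl , u′ , there , Unique[x∷xs]⇒x∉xs u
  unique-remove (there x∈xs) (y∉xs ∷ u) with unique-remove x∈xs u
  ... | ys , len , u′ , ys⊆xs , x∉ys =
    _ ∷ ys , cong suc len , All.tabulate (All.lookup y∉xs ∘ ys⊆xs) ∷ u′ ,
    (λ { (here refl) → here refl ; (there z∈ys) → there (ys⊆xs z∈ys) }) ,
    (λ { (here refl) → All.lookup y∉xs x∈xs refl ; (there x∈ys) → x∉ys x∈ys })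

  map⁺-injectiveOn : ∀ {B : Set} {f : A → B} {xs} →
            (∀ {x y} → x ∈ xs → y ∈ xs → f x ≡ f y → x ≡ y) → Unique xs → Unique (map f xs)
  map⁺-injectiveOn {xs = []} _ [] = []
  map⁺-injectiveOn {f = f} {xs = x ∷ xs} inj (x∉xs ∷ u) =
    All.tabulate fx∉ ∷ map⁺-injectiveOn (λ y∈ z∈ → inj (there y∈) (there z∈)) u
    where
    fx∉ : ∀ {z} → z ∈ map f xs → f x ≢ z
    fx∉ z∈ fx≡z with ∈-map⁻ f z∈
    ... | y , y∈xs , refl = All.lookup x∉xs y∈xs (inj (here refl) (there y∈xs) fx≡z)

-- cliqueNumberOver C L is the size of a largest clique inside L all of whose members
-- are related to every member of C; cliques include the diagonal, so R a a is needed.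
module Cliques {A : Set} (_≟_ : DecidableEquality A)
               {R : A → A → Set} (R? : Decidable R) where

  open DecMembership _≟_ using (_∈?_)

  IsClique : List A → Set
  IsClique G = ∀ {a b} → a ∈ G → b ∈ G → R a b

  cliqueNumberOver : List A → List A → ℕ
  cliqueNumberOver C [] = 0
  cliqueNumberOver C (a ∷ L) with All.all? (R? a) (a ∷ C)
  ... | yes _ = cliqueNumberOver C L ⊔ suc (cliqueNumberOver (a ∷ C) L)
  ... | no _  = cliqueNumberOver C L

  cliqueNumber : List A → ℕ
  cliqueNumber = cliqueNumberOver []

  cliqueNumberOver-∷ : ∀ C a L → cliqueNumberOver C L ≤ cliqueNumberOver C (a ∷ L)
  cliqueNumberOver-∷ C a L with All.all? (R? a) (a ∷ C)
  ... | yes _ = m≤m⊔n _ _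
  ... | no _  = ≤-refl

  length≤cliqueNumberOver : ∀ C L {G} → Unique G → G ⊆ L → IsClique G →
    (∀ {g c} → g ∈ G → c ∈ C → R g c) → length G ≤ cliqueNumberOver C L
  length≤cliqueNumberOver C [] {[]} _ _ _ _ = z≤n
  length≤cliqueNumberOver C [] {_ ∷ _} _ G⊆[] _ _ with G⊆[] (here refl)
  ... | ()
  length≤cliqueNumberOver C (a ∷ L) {G} uG G⊆ clique related with a ∈? G
  ... | no a∉G =
    ≤-trans (length≤cliqueNumberOver C L uG G⊆L clique related) (cliqueNumberOver-∷ C a L)
    where
    G⊆L : G ⊆ L
    G⊆L g∈G = ∈-tail (G⊆ g∈G) λ { refl → a∉G g∈G }
  ... | yes a∈G with All.all? (R? a) (a ∷ C) | unique-remove a∈G uG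
  ...   | no ¬a-related | _ =
    contradiction (clique a∈G a∈G ∷ All.tabulate (related a∈G)) ¬a-related
  ...   | yes _ | G′ , len , uG′ , G′⊆G , a∉G′ rewrite len =
    ≤-trans (s≤s (length≤cliqueNumberOver (a ∷ C) L uG′ G′⊆L clique′ related′)) (m≤n⊔m _ _)
    where
    G′⊆L : G′ ⊆ L
    G′⊆L g∈G′ = ∈-tail (G⊆ (G′⊆G g∈G′)) λ { refl → a∉G′ g∈G′ }
    clique′ : IsClique G′
    clique′ g∈G′ h∈G′ = clique (G′⊆G g∈G′) (G′⊆G h∈G′)
    related′ : ∀ {g c} → g ∈ G′ → c ∈ a ∷ C → R g c
    related′ g∈G′ (here refl) = clique (G′⊆G g∈G′) a∈G
    related′ g∈G′ (there c∈C) = related (G′⊆G g∈G′) c∈C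

  length≤cliqueNumber : ∀ {L G} → Unique G → G ⊆ L → IsClique G → length G ≤ cliqueNumber L
  length≤cliqueNumber uG G⊆L clique = length≤cliqueNumberOver [] _ uG G⊆L clique λ _ ()

module _ {n : ℕ} where

  ∈-U⁺ : ∀ {F : Family n} {A x} → A ∈ F → x S.∈ A → x S.∈ U F
  ∈-U⁺ (here refl) x∈A = x∈p∪q⁺ (inj₁ x∈A)
  ∈-U⁺ (there A∈F) x∈A = x∈p∪q⁺ (inj₂ (∈-U⁺ A∈F x∈A))

  ∈-U⁻ : ∀ (F : Family n) {x} → x S.∈ U F → ∃[ A ] A ∈ F × x S.∈ A
  ∈-U⁻ [] x∈⊥ = contradiction x∈⊥ ∉⊥
  ∈-U⁻ (A ∷ F) x∈U with x∈p∪q⁻ A (U F) x∈U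
  ... | inj₁ x∈A = A , here refl , x∈A
  ... | inj₂ x∈UF with ∈-U⁻ F x∈UF
  ...   | B , B∈F , x∈B = B , there B∈F , x∈B

  star-centre∈U : ∀ {F : Family n} {x} → 1 ≤ length F → (∀ {A} → A ∈ F → x S.∈ A) → x S.∈ U F
  star-centre∈U {A ∷ F} _ x∈F = ∈-U⁺ {F = A ∷ F} (here refl) (x∈F (here refl))

  star⇒intersecting : ∀ {F : Family n} {x} → (∀ {A} → A ∈ F → x S.∈ A) → IsIntersecting F
  star⇒intersecting x∈F A∈F B∈F = _ , x∈p∩q⁺ (x∈F A∈F , x∈F B∈F)

_≟ₛ_ : ∀ {k} → DecidableEquality (Subset k)
_≟ₛ_ = ≡-dec Bool._≟_

_⊆?_ : ∀ {k} → Decidable (_⊆_ {A = Subset k})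
_⊆?_ = DecSubset._⊆?_ _≟ₛ_

section : ∀ {k} → Side → Family (suc k) → Family k
section b D = map tail (filter ((Bool._≟ b) ∘ head) D)

module _ {k} {D : Family (suc k)} {b : Side} {A : Subset k} where

  ∈-section⁺ : b ∷ A ∈ D → A ∈ section b D
  ∈-section⁺ bA∈D = ∈-map∘filter⁺ tail ((Bool._≟ b) ∘ head) (b ∷ A , bA∈D , refl , refl)

  ∈-section⁻ : A ∈ section b D → b ∷ A ∈ D
  ∈-section⁻ A∈ with ∈-map∘filter⁻ tail ((Bool._≟ b) ∘ head) A∈
  ... | _ ∷ _ , bA∈D , refl , refl = bA∈D

section-downset : ∀ {k} {D : Family (suc k)} b → IsDownset D → IsDownset (section b D)
section-downset b downset A∈ B⊆A = ∈-section⁺ (downset (∈-section⁻ A∈) (s⊆s B⊆A))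

section-inside⊆section-outside : ∀ {k} {D : Family (suc k)} → IsDownset D →
  section inside D ⊆ section outside D
section-inside⊆section-outside downset A∈ = ∈-section⁺ (downset (∈-section⁻ A∈) (out⊆ ⊆-refl))

glue : ∀ {k} → Family k → Family k → Family (suc k)
glue D₀ D₁ = map (outside ∷_) D₀ ++ map (inside ∷_) D₁

downsets : ∀ k → List (Family k)
downsets zero = [] ∷ [ [ [] ] ]
downsets (suc k) = concatMap (λ D₀ → map (glue D₀) (filter (_⊆? D₀) (downsets k))) (downsets k)

downsets-complete : ∀ {k} (D : Family k) → IsDownset D →
  ∃[ L ] L ∈ downsets k × D ⊆ L × L ⊆ D
downsets-complete {zero} [] _ = [] , here refl , (λ ()) , (λ ())
downsets-complete {zero} ([] ∷ D) _ =
  [ [] ] , there (here refl) , (λ { {[]} _ → here refl }) , (λ { (here refl) → here refl })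
downsets-complete {suc k} D downset
  with downsets-complete (section outside D) (section-downset outside downset)
     | downsets-complete (section inside D) (section-downset inside downset)
... | L₀ , L₀∈ , D₀⊆L₀ , L₀⊆D₀ | L₁ , L₁∈ , D₁⊆L₁ , L₁⊆D₁ =
  glue L₀ L₁ , glue∈downsets , D⊆glue , glue⊆D
  where
  L₁⊆L₀ : L₁ ⊆ L₀
  L₁⊆L₀ = D₀⊆L₀ ∘ section-inside⊆section-outside downset ∘ L₁⊆D₁
  glue∈downsets : glue L₀ L₁ ∈ downsets (suc k)
  glue∈downsets = ∈-concat⁺′ (∈-map⁺ (glue L₀) (∈-filter⁺ (_⊆? L₀) L₁∈ L₁⊆L₀)) (∈-map⁺ _ L₀∈)
  D⊆glue : D ⊆ glue L₀ L₁
  D⊆glue {outside ∷ A} A∈D = ∈-++⁺ˡ (∈-map⁺ (outside ∷_) (D₀⊆L₀ (∈-section⁺ A∈D)))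
  D⊆glue {inside ∷ A} A∈D = ∈-++⁺ʳ _ (∈-map⁺ (inside ∷_) (D₁⊆L₁ (∈-section⁺ A∈D)))
  glue⊆D : glue L₀ L₁ ⊆ D
  glue⊆D A∈ with ∈-++⁻ (map (outside ∷_) L₀) A∈
  ... | inj₁ A∈₀ with ∈-map⁻ (outside ∷_) A∈₀
  ...   | _ , A∈L₀ , refl = ∈-section⁻ (L₀⊆D₀ A∈L₀)
  glue⊆D A∈ | inj₂ A∈₁ with ∈-map⁻ (inside ∷_) A∈₁
  ...   | _ , A∈L₁ , refl = ∈-section⁻ (L₁⊆D₁ A∈L₁)

glue-unique : ∀ {k} {D₀ D₁ : Family k} → Unique D₀ → Unique D₁ → Unique (glue D₀ D₁)
glue-unique u₀ u₁ = ++⁺ (map⁺ ∷-injectiveʳ u₀) (map⁺ ∷-injectiveʳ u₁) disjoint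
  where
  disjoint : ∀ {A} → ¬ (A ∈ map (outside ∷_) _ × A ∈ map (inside ∷_) _)
  disjoint (A∈₀ , A∈₁) with ∈-map⁻ (outside ∷_) A∈₀ | ∈-map⁻ (inside ∷_) A∈₁
  ... | _ , _ , refl | _ , _ , ()

downsets-unique : ∀ {k L} → L ∈ downsets k → Unique L
downsets-unique {zero} (here refl) = []
downsets-unique {zero} (there (here refl)) = [] ∷ []
downsets-unique {suc k} L∈ with ∈-concat⁻′ (map _ (downsets k)) L∈
... | _ , L∈glues , glues∈ with ∈-map⁻ _ glues∈
...   | L₀ , L₀∈ , refl with ∈-map⁻ (glue L₀) L∈glues
...     | L₁ , L₁∈ , refl =
  glue-unique (downsets-unique L₀∈) (downsets-unique (proj₁ (∈-filter⁻ (_⊆? L₀) L₁∈)))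

meets? : ∀ {k} → Decidable (λ (A B : Subset k) → Nonempty (A ∩ B))
meets? A B = nonempty? (A ∩ B)

module IntersectingCliques {k} = Cliques (_≟ₛ_ {k}) (meets? {k})
open IntersectingCliques using (cliqueNumber; length≤cliqueNumber)

star : ∀ {k} → Fin k → Family k → Family k
star x = filter (x ∈ₛ?_)

HasMaximumStar : ∀ {k} → Family k → Set
HasMaximumStar L = ∃[ x ] cliqueNumber L ≤ length (star x L)

hasMaximumStar? : ∀ {k} (L : Family k) → Dec (HasMaximumStar L)
hasMaximumStar? L = any? (λ x → cliqueNumber L ≤? length (star x L))

downsets-haveMaximumStar : ∀ {k} → k ≤ 3 → All HasMaximumStar (downsets (suc k))
downsets-haveMaximumStar {0} _ = from-yes (All.all? hasMaximumStar? (downsets 1))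
downsets-haveMaximumStar {1} _ = from-yes (All.all? hasMaximumStar? (downsets 2))
downsets-haveMaximumStar {2} _ = from-yes (All.all? hasMaximumStar? (downsets 3))
downsets-haveMaximumStar {3} _ = from-yes (All.all? hasMaximumStar? (downsets 4))
downsets-haveMaximumStar {suc (suc (suc (suc _)))} (s≤s (s≤s (s≤s ())))

downset-hasStarProperty : ∀ {k} → k ≤ 4 → (D : Family k) → IsDownset D → Nonempty (U D) →
  HasStarProperty D
downset-hasStarProperty {zero} _ _ _ (() , _)
downset-hasStarProperty {suc k} (s≤s k≤3) D downset (y , y∈UD) with downsets-complete D downset
... | L , L∈ , D⊆L , L⊆D with All.lookup (downsets-haveMaximumStar k≤3) L∈
...   | x , maximum≤star =
  F , ((uniqueF , L⊆D ∘ F⊆L) , star⇒intersecting x∈F , maximal) , x , x∈UF , x∈F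
  where
  F : Family (suc k)
  F = star x L
  uniqueF : Unique F
  uniqueF = filter⁺ (x ∈ₛ?_) (downsets-unique L∈)
  F⊆L : F ⊆ L
  F⊆L = proj₁ ∘ ∈-filter⁻ (x ∈ₛ?_) {xs = L}
  x∈F : ∀ {A} → A ∈ F → x S.∈ A
  x∈F = proj₂ ∘ ∈-filter⁻ (x ∈ₛ?_) {xs = L}
  maximal : ∀ G → SubfamilyOf G D → IsIntersecting G → length G ≤ length F
  maximal G (uniqueG , G⊆D) intersecting =
    ≤-trans (length≤cliqueNumber uniqueG (D⊆L ∘ G⊆D) intersecting) maximum≤star
  x∈UF : x S.∈ U F
  x∈UF with ∈-U⁻ D y∈UD
  ... | A , A∈D , y∈A =
    star-centre∈U (maximal [ A ] ([] ∷ [] , λ { (here refl) → A∈D }) singleton) x∈F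
    where
    singleton : IsIntersecting [ A ]
    singleton (here refl) (here refl) = y , x∈p∩q⁺ (y∈A , y∈A)

enumerate : ∀ {n} (p : Subset n) → Fin ∣ p ∣ → Fin n
enumerate (inside ∷ p) zero = zero
enumerate (inside ∷ p) (suc i) = suc (enumerate p i)
enumerate (outside ∷ p) i = suc (enumerate p i)

enumerate-injective : ∀ {n} (p : Subset n) → Injective _≡_ _≡_ (enumerate p)
enumerate-injective (inside ∷ p) {zero} {zero} _ = refl
enumerate-injective (inside ∷ p) {suc i} {suc j} eq =
  cong suc (enumerate-injective p (suc-injective eq))
enumerate-injective (outside ∷ p) eq = enumerate-injective p (suc-injective eq)

enumerate-surjective : ∀ {n} {p : Subset n} {y} → y S.∈ p → ∃[ i ] enumerate p i ≡ y
enumerate-surjective {p = inside ∷ p} Vec.here = zero , refl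
enumerate-surjective {p = inside ∷ p} (Vec.there y∈p) with enumerate-surjective y∈p
... | i , refl = suc i , refl
enumerate-surjective {p = outside ∷ p} (Vec.there y∈p) with enumerate-surjective y∈p
... | i , refl = i , refl

module Relabel {m n} (σ : Fin m → Fin n) (σ-injective : Injective _≡_ _≡_ σ) where

  preimage : Subset n → Subset m
  preimage A = tabulate (λ i → lookup A (σ i))

  image : Subset m → Subset n
  image B = U (map (⁅_⁆ ∘ σ) (filter (_∈ₛ? B) (allFin m)))

  ∈-preimage⁺ : ∀ {A i} → σ i S.∈ A → i S.∈ preimage A
  ∈-preimage⁺ {A} {i} σi∈A = lookup⇒[]= i _ (trans (lookup∘tabulate _ i) ([]=⇒lookup σi∈A))

  ∈-preimage⁻ : ∀ {A i} → i S.∈ preimage A → σ i S.∈ A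
  ∈-preimage⁻ {A} {i} i∈ = lookup⇒[]= (σ i) A (trans (sym (lookup∘tabulate _ i)) ([]=⇒lookup i∈))

  ∈-image⁺ : ∀ {B i} → i S.∈ B → σ i S.∈ image B
  ∈-image⁺ {B} {i} i∈B = ∈-U⁺ (∈-map⁺ (⁅_⁆ ∘ σ) (∈-filter⁺ (_∈ₛ? B) (∈-allFin i) i∈B)) (x∈⁅x⁆ (σ i))

  ∈-image⁻ : ∀ {B y} → y S.∈ image B → ∃[ i ] i S.∈ B × σ i ≡ y
  ∈-image⁻ {B} y∈ with ∈-U⁻ (map (⁅_⁆ ∘ σ) (filter (_∈ₛ? B) (allFin m))) y∈
  ... | _ , ⁅σi⁆∈ , y∈⁅σi⁆ with ∈-map⁻ (⁅_⁆ ∘ σ) ⁅σi⁆∈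
  ...   | i , i∈ , refl =
    i , proj₂ (∈-filter⁻ (_∈ₛ? B) {xs = allFin m} i∈) , sym (x∈⁅y⁆⇒x≡y (σ i) y∈⁅σi⁆)

  image⊆ : ∀ {A B} → B S.⊆ preimage A → image B S.⊆ A
  image⊆ B⊆ y∈ with ∈-image⁻ y∈
  ... | i , i∈B , refl = ∈-preimage⁻ (B⊆ i∈B)

  preimage-image : ∀ B → preimage (image B) ≡ B
  preimage-image B = ⊆-antisym ⊆B (∈-preimage⁺ ∘ ∈-image⁺)
    where
    ⊆B : preimage (image B) S.⊆ B
    ⊆B i∈ with ∈-image⁻ (∈-preimage⁻ i∈)
    ... | j , j∈B , σj≡σi = subst (S._∈ B) (σ-injective σj≡σi) j∈B

  image-preimage : ∀ {A} → (∀ {y} → y S.∈ A → ∃[ i ] σ i ≡ y) → image (preimage A) ≡ A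
  image-preimage {A} covers = ⊆-antisym (image⊆ ⊆-refl) A⊆
    where
    A⊆ : A S.⊆ image (preimage A)
    A⊆ y∈A with covers y∈A
    ... | i , refl = ∈-image⁺ (∈-preimage⁺ y∈A)

  module _ (D : Family n) (covers : ∀ {y} → y S.∈ U D → ∃[ i ] σ i ≡ y) where

    image-preimage-member : ∀ {A} → A ∈ D → image (preimage A) ≡ A
    image-preimage-member A∈D = image-preimage (covers ∘ ∈-U⁺ A∈D)

    preimage-downset : IsDownset D → IsDownset (map preimage D)
    preimage-downset downset {B = B} A∈ B⊆A with ∈-map⁻ preimage A∈
    ... | A , A∈D , refl =
      subst (_∈ map preimage D) (preimage-image B) (∈-map⁺ preimage (downset A∈D (image⊆ B⊆A)))

    preimage-nonempty : Nonempty (U D) → Nonempty (U (map preimage D))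
    preimage-nonempty (y , y∈UD) with ∈-U⁻ D y∈UD | covers y∈UD
    ... | A , A∈D , y∈A | i , refl = i , ∈-U⁺ (∈-map⁺ preimage A∈D) (∈-preimage⁺ y∈A)

    preimage-unique : ∀ {G} → G ⊆ D → Unique G → Unique (map preimage G)
    preimage-unique G⊆D = map⁺-injectiveOn λ A∈ B∈ eq →
      trans (sym (image-preimage-member (G⊆D A∈)))
            (trans (cong image eq) (image-preimage-member (G⊆D B∈)))

    preimage-intersecting : ∀ {G} → G ⊆ D → IsIntersecting G → IsIntersecting (map preimage G)
    preimage-intersecting G⊆D intersecting A∈ B∈ with ∈-map⁻ preimage A∈ | ∈-map⁻ preimage B∈
    ... | A , A∈G , refl | B , B∈G , refl with intersecting A∈G B∈G
    ...   | y , y∈A∩B with covers (∈-U⁺ (G⊆D A∈G) (p∩q⊆p A B y∈A∩B))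
    ...     | i , refl = i , x∈p∩q⁺ (∈-preimage⁺ (p∩q⊆p A B y∈A∩B) , ∈-preimage⁺ (p∩q⊆q A B y∈A∩B))

    hasStarProperty-preimage : HasStarProperty (map preimage D) → HasStarProperty D
    hasStarProperty-preimage (F , ((uniqueF , F⊆) , _ , maximalF) , x , x∈UF , x∈F) =
      map image F , ((uniqueImage , image⊆D) , star⇒intersecting σx∈ , maximal) , σ x , σx∈U , σx∈
      where
      uniqueImage : Unique (map image F)
      uniqueImage = map⁺ (λ {B} {B′} eq →
        trans (sym (preimage-image B)) (trans (cong preimage eq) (preimage-image B′))) uniqueF
      image⊆D : map image F ⊆ D
      image⊆D A∈ with ∈-map⁻ image A∈
      ... | B , B∈F , refl with ∈-map⁻ preimage (F⊆ B∈F)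
      ...   | A , A∈D , refl = subst (_∈ D) (sym (image-preimage-member A∈D)) A∈D
      σx∈ : ∀ {A} → A ∈ map image F → σ x S.∈ A
      σx∈ A∈ with ∈-map⁻ image A∈
      ... | B , B∈F , refl = ∈-image⁺ (x∈F B∈F)
      σx∈U : σ x S.∈ U (map image F)
      σx∈U with ∈-U⁻ F x∈UF
      ... | B , B∈F , x∈B = ∈-U⁺ (∈-map⁺ image B∈F) (∈-image⁺ x∈B)
      maximal : ∀ G → SubfamilyOf G D → IsIntersecting G → length G ≤ length (map image F)
      maximal G (uniqueG , G⊆D) intersecting = begin
        length G                  ≡⟨ length-map preimage G ⟨
        length (map preimage G)   ≤⟨ maximalF (map preimage G)
                                        (preimage-unique G⊆D uniqueG , Subset.map⁺ preimage G⊆D)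
                                        (preimage-intersecting G⊆D intersecting) ⟩
        length F                  ≡⟨ length-map image F ⟨
        length (map image F)      ∎
        where open ≤-Reasoning

proposition2p12 : ∀ (n : ℕ) (D : Family n) → IsDownset D → Nonempty (U D) →
    ∣ U D ∣ ≤ 4 → HasStarProperty D
proposition2p12 n D downset nonempty ∣UD∣≤4 =
  hasStarProperty-preimage D enumerate-surjective
    (downset-hasStarProperty ∣UD∣≤4 (map preimage D)
      (preimage-downset D enumerate-surjective downset)
      (preimage-nonempty D enumerate-surjective nonempty))
  where open Relabel (enumerate (U D)) (enumerate-injective (U D))
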